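{- Let $c$ be a constant and let $G_0$ be an identifiable graph of order $n_0$ and maximum degree $\Delta_0$ with $\gamma^{\rm ID}(G_0)\le\left(\frac{\Delta_0-1}{\Delta_0}\right)n_0+c$. Let $p\ge1$ be an integer and, for $i\in\{1,\dots,p\}$, let $S_i$ be a $\Delta_i$-star with $\Delta_i\ge3$ and $G_i=G_{i-1}\rhd_{v_{i-1}}S_i$, where $v_{i-1}$ is a vertex of $G_{i-1}$. Let $G=G_p$ have order $n$ and maximum degree $\Delta$, and let $\Delta_{\max}=\max\{\Delta_i:0\le i\le p\}$. Then \[ \gamma^{\rm ID}(G)\le\left(\frac{\Delta_{\max}-1}{\Delta_{\max}}\right)n+c\le\left(\frac{\Delta-1}{\Delta}\right)n+c. \]
   Context: A graph is identifiable if no two distinct vertices have the same closed neighborhood $N[\cdot]$. An identifying code of $G$ is a set $C\subseteq V(G)$ such that every vertex $v$ satisfies $N[v]\cap C\neq\emptyset$ and distinct vertices $u,v$ satisfy $N[u]\cap C\neq N[v]\cap C$; $\gamma^{\rm ID}(G)$ is its minimum size. A $\Delta$-star is $K_{1,\Delta}$. $G'\rhd_v S$ denotes the graph obtained from the disjoint union of $G'$ and a star $S$ by identifying the vertex $v$ of $G'$ with a leaf of $S$.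
   Formalization: The constant c is taken to be rational. -}

module Defs where

open import Data.Bool using (Bool; true; false; _∨_; if_then_else_)
open import Data.Nat using (ℕ; zero; suc; _+_; _⊔_)
open import Data.Fin using (Fin; splitAt) renaming (zero to fz; suc to fs)
open import Data.Fin.Properties using (_≟_)
open import Data.Sum using (_⊎_; inj₁; inj₂)
open import Data.Product using (Σ; _×_; _,_)
open import Data.List using (List; allFin; map; foldr)
open import Data.Nat.ListAction using (sum)
open import Data.Integer using (+_)
open import Data.Rational using (ℚ; 0ℚ; _/_)
open import Relation.Nullary using (¬_; does)
open import Relation.Binary.PropositionalEquality using (_≡_; _≢_)

Graph : ℕ → Set
Graph n = Fin n → Fin n → Bool

record IsSimple {n : ℕ} (G : Graph n) : Set where
  field
    symm    : ∀ u v → G u v ≡ G v u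
    irrefl  : ∀ v → G v v ≡ false

closedN : ∀ {n} → Graph n → Fin n → Fin n → Bool
closedN G v u = does (v ≟ u) ∨ G v u

count : ∀ {n} → (Fin n → Bool) → ℕ
count {n} C = sum (map (λ i → if C i then 1 else 0) (allFin n))

degree : ∀ {n} → Graph n → Fin n → ℕ
degree G v = count (G v)

maxDegree : ∀ {n} → Graph n → ℕ
maxDegree {n} G = foldr _⊔_ 0 (map (degree G) (allFin n))

Identifiable : ∀ {n} → Graph n → Set
Identifiable {n} G = ∀ (u v : Fin n) → u ≢ v → Σ (Fin n) λ w → closedN G u w ≢ closedN G v w

IsIdCode : ∀ {n} → Graph n → (Fin n → Bool) → Set
IsIdCode {n} G C =
  (∀ (v : Fin n) → Σ (Fin n) λ u → (C u ≡ true) × (closedN G v u ≡ true))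
  × (∀ (u v : Fin n) → u ≢ v →
       Σ (Fin n) λ w → (C w ≡ true) × (closedN G u w ≢ closedN G v w))

IsGammaID : ∀ {n} → Graph n → ℕ → Set
IsGammaID G k =
  (Σ _ λ C → IsIdCode G C × (count C ≡ k))
  × (∀ C → IsIdCode G C → k Data.Nat.≤ count C)

-- G ▷_v S where S = K_{1,d}: one leaf of S is identified with v.
-- New vertices: inj₂ fz is the centre, inj₂ (fs j) are the d-1 remaining leaves.
attachStar : ∀ {n} → Graph n → Fin n → (d : ℕ) → Graph (n + d)
attachStar {n} G v d x y = go (splitAt n x) (splitAt n y)
  where
  go : Fin n ⊎ Fin d → Fin n ⊎ Fin d → Bool
  go (inj₁ a) (inj₁ b) = G a b
  go (inj₁ a) (inj₂ fz) = does (a ≟ v)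
  go (inj₂ fz) (inj₁ a) = does (a ≟ v)
  go (inj₂ fz) (inj₂ (fs _)) = true
  go (inj₂ (fs _)) (inj₂ fz) = true
  go _ _ = false

-- A sequence of star attachments starting from a graph of order n:
-- each step gives the vertex v_{i-1} of the current graph G_{i-1} and Δ_i.
data Chain (n : ℕ) : Set where
  done : Chain n
  step : (v : Fin n) (d : ℕ) → Chain (n + d) → Chain n

finalOrder : ∀ {n} → Chain n → ℕ
finalOrder {n} done = n
finalOrder (step v d ch) = finalOrder ch

build : ∀ {n} → Graph n → (ch : Chain n) → Graph (finalOrder ch)
build G done = G
build G (step v d ch) = build (attachStar G v d) ch

chainLength : ∀ {n} → Chain n → ℕ
chainLength done = 0
chainLength (step v d ch) = suc (chainLength ch)

AllDegGe3 : ∀ {n} → Chain n → Set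
AllDegGe3 done = Data.Unit.⊤ where import Data.Unit
AllDegGe3 (step v d ch) = (3 Data.Nat.≤ d) × AllDegGe3 ch

chainMaxDeg : ∀ {n} → Chain n → ℕ
chainMaxDeg done = 0
chainMaxDeg (step v d ch) = d ⊔ chainMaxDeg ch

-- (D - 1) / D as a rational (only used for D ≥ 1; value 0 at D = 0 is a dummy)
ratio : ℕ → ℚ
ratio zero = 0ℚ
ratio (suc k) = (+ k) / suc k

{-# OPTIONS --safe #-}

-- Let D = Δmax. Attaching a Δᵢ-star to a graph with identifying code C yields the identifying code
-- C ∪ {the Δᵢ − 1 leaves other than vᵢ₋₁}, of size |C| + Δᵢ − 1 on a graph with Δᵢ more vertices.
-- Since Δᵢ ≤ D, we have Δᵢ − 1 ≤ ((D − 1)/D)·Δᵢ, so along the whole chain the potential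
-- D·|C| − (D − 1)·|V| does not increase. Starting from a minimum code of G₀, whose size satisfies the
-- bound with (Δ₀ − 1)/Δ₀ ≤ (D − 1)/D, gives the first inequality. The second holds because every Δᵢ
-- is the degree of a star centre in G, and attaching stars never lowers degrees, so D ≤ Δ.
module Submission where

open import Defs
open import Data.Bool using (Bool; true; false; _∨_; if_then_else_)
open import Data.Bool.Properties using (∨-zeroʳ)
open import Data.Empty using (⊥-elim)
open import Data.Fin using (Fin; zero; suc; splitAt; _↑ˡ_; _↑ʳ_; punchIn)
open import Data.Fin.Properties
  using (_≟_; splitAt-↑ˡ; splitAt-↑ʳ; splitAt⁻¹-↑ˡ; splitAt⁻¹-↑ʳ; ↑ˡ-injective; ↑ʳ-injective;
         suc-injective; punchInᵢ≢i)
open import Data.Integer as ℤ using (+_; +≤+)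
import Data.Integer.Properties as ℤ
open import Data.Integer.Tactic.RingSolver using (solve-∀)
open import Data.List using (allFin)
open import Data.List.Membership.Propositional.Properties using (∈-map⁺; ∈-allFin)
open import Data.List.Properties using (map-tabulate; map-cong; foldr-preservesᵇ; foldr-preservesᵒ)
import Data.List.Relation.Unary.Any as Any
open import Data.List.Relation.Unary.All.Properties using (map⁺; tabulate⁺)
open import Data.Nat as ℕ using (ℕ; zero; suc; _≤_; _⊔_; z≤n; s≤s)
open import Data.Nat.ListAction using (sum)
import Data.Nat.Properties as ℕ
import Data.Nat.Tactic.RingSolver as ℕSolver
open import Data.Product using (Σ; _×_; _,_)
open import Data.Rational using (ℚ; toℚᵘ; -_; _+_; _*_; _/_; NonNegative) renaming (_≤_ to _≤ℚ_)
open import Data.Rational.Properties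
  using (toℚᵘ-cancel-≤; toℚᵘ-fromℚᵘ; toℚᵘ-injective; toℚᵘ-homo-+; toℚᵘ-homo-*;
         normalize-nonNeg; +-monoˡ-≤; *-monoʳ-≤-nonNeg)
  renaming (_≤?_ to _≤ℚ?_)
import Data.Rational.Properties as ℚ using (module ≤-Reasoning)
import Data.Rational.Solver as ℚSolver
open import Data.Rational.Unnormalised as ℚᵘ using (mkℚᵘ; *≡*; *≤*)
import Data.Rational.Unnormalised.Properties as ℚᵘ
open import Data.Sum using (inj₁; inj₂; [_,_])
open import Function using (_∘_)
open import Relation.Binary.PropositionalEquality
  using (_≡_; _≢_; refl; sym; trans; cong; cong₂; subst; subst₂; module ≡-Reasoning)
open import Relation.Nullary using (¬_; does; yes; no)
open import Relation.Nullary.Decidable using (dec-true; dec-false; decidable-stable)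
open import Relation.Nullary.Negation using (¬¬-map)

ι : ℕ → ℚ
ι n = + n / 1

ι-nonNeg : ∀ n → NonNegative (ι n)
ι-nonNeg n = normalize-nonNeg n 1

+/-mono-≤ : ∀ a m b m′ → a ℕ.* suc m′ ≤ b ℕ.* suc m → (+ a / suc m) ≤ℚ (+ b / suc m′)
+/-mono-≤ a m b m′ cross = toℚᵘ-cancel-≤ (begin
    toℚᵘ (+ a / suc m)  ≃⟨ toℚᵘ-fromℚᵘ (mkℚᵘ (+ a) m) ⟩
    mkℚᵘ (+ a) m        ≤⟨ *≤* (subst₂ ℤ._≤_ (ℤ.pos-* a _) (ℤ.pos-* b _) (+≤+ cross)) ⟩
    mkℚᵘ (+ b) m′       ≃⟨ toℚᵘ-fromℚᵘ (mkℚᵘ (+ b) m′) ⟨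
    toℚᵘ (+ b / suc m′) ∎)
  where open ℚᵘ.≤-Reasoning

ratio-mono-≤ : ∀ {a b} → 1 ≤ a → a ≤ b → ratio a ≤ℚ ratio b
ratio-mono-≤ {suc x} {suc y} _ (s≤s x≤y) = +/-mono-≤ x x y y (begin
    x ℕ.* suc y    ≡⟨ ℕ.*-suc x y ⟩
    x ℕ.+ x ℕ.* y  ≤⟨ ℕ.+-mono-≤ x≤y (ℕ.≤-reflexive (ℕ.*-comm x y)) ⟩
    y ℕ.+ y ℕ.* x  ≡⟨ ℕ.*-suc y x ⟨
    y ℕ.* suc x    ∎)
  where open ℕ.≤-Reasoning

ι+frac*ι : ∀ m p a b → ι a + (+ p / suc m) * ι b ≡ + (suc m ℕ.* a ℕ.+ p ℕ.* b) / suc m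
ι+frac*ι m p a b = toℚᵘ-injective (begin-equality
    toℚᵘ (ι a + (+ p / suc m) * ι b)
      ≃⟨ toℚᵘ-homo-+ (ι a) _ ⟩
    toℚᵘ (ι a) ℚᵘ.+ toℚᵘ ((+ p / suc m) * ι b)
      ≃⟨ ℚᵘ.+-cong (toℚᵘ-fromℚᵘ (mkℚᵘ (+ a) 0))
           (ℚᵘ.≃-trans (toℚᵘ-homo-* (+ p / suc m) (ι b))
             (ℚᵘ.*-cong (toℚᵘ-fromℚᵘ (mkℚᵘ (+ p) m)) (toℚᵘ-fromℚᵘ (mkℚᵘ (+ b) 0)))) ⟩
    mkℚᵘ (+ a) 0 ℚᵘ.+ mkℚᵘ (+ p) m ℚᵘ.* mkℚᵘ (+ b) 0
      ≃⟨ *≡* (cross-multiplied (m ℕ.* 1) (ℕ.*-identityʳ m)) ⟩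
    mkℚᵘ (+ N) m
      ≃⟨ toℚᵘ-fromℚᵘ (mkℚᵘ (+ N) m) ⟨
    toℚᵘ (+ N / suc m) ∎)
  where
  open ℚᵘ.≤-Reasoning
  N : ℕ
  N = suc m ℕ.* a ℕ.+ p ℕ.* b
  -- Unnormalised arithmetic leaves the denominator suc m as suc (m * 1), hence the detour via m′.
  cross-multiplied : ∀ m′ → m′ ≡ m →
    (+ a ℤ.* + suc m′ ℤ.+ (+ p ℤ.* + b) ℤ.* + 1) ℤ.* + suc m ≡ + N ℤ.* (+ 1 ℤ.* + suc m′)
  cross-multiplied m′ refl = trans (regroup (+ a) (+ b) (+ p) (+ suc m))
    (cong (ℤ._* (+ 1 ℤ.* + suc m))
      (sym (trans (ℤ.pos-+ (suc m ℕ.* a) (p ℕ.* b)) (cong₂ ℤ._+_ (ℤ.pos-* (suc m) a) (ℤ.pos-* p b)))))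
    where
    regroup : ∀ a b p s →
      (a ℤ.* s ℤ.+ (p ℤ.* b) ℤ.* + 1) ℤ.* s ≡ (s ℤ.* a ℤ.+ p ℤ.* b) ℤ.* (+ 1 ℤ.* s)
    regroup = solve-∀

+-cancelʳ-≤ : ∀ r {p q} → p + r ≤ℚ q + r → p ≤ℚ q
+-cancelʳ-≤ r {p} {q} p+r≤q+r = subst₂ _≤ℚ_ (cancel p) (cancel q) (+-monoˡ-≤ (- r) p+r≤q+r)
  where
  open ℚSolver.+-*-Solver
  cancel : ∀ x → x + r + - r ≡ x
  cancel x = solve 2 (λ x r → x :+ r :+ :- r := x) refl x r

-- Dividing the hypothesis by D = suc e gives k + r·n₀ ≤ k₀ + r·n with r = (D − 1)/D;
-- then k₀ ≤ r₀·n₀ + c ≤ r·n₀ + c and r·n₀ cancels.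
slope-bound : ∀ c e {k k₀ n₀ n} {r₀} →
  suc e ℕ.* k ℕ.+ e ℕ.* n₀ ≤ suc e ℕ.* k₀ ℕ.+ e ℕ.* n →
  r₀ ≤ℚ ratio (suc e) → ι k₀ ≤ℚ r₀ * ι n₀ + c → ι k ≤ℚ ratio (suc e) * ι n + c
slope-bound c e {k} {k₀} {n₀} {n} {r₀} potential r₀≤r k₀-bound = +-cancelʳ-≤ (r * ι n₀) (begin
    ι k + r * ι n₀            ≡⟨ ι+frac*ι e e k n₀ ⟩
    + lhs / suc e             ≤⟨ +/-mono-≤ lhs e rhs e (ℕ.*-monoˡ-≤ (suc e) potential) ⟩
    + rhs / suc e             ≡⟨ ι+frac*ι e e k₀ n ⟨
    ι k₀ + r * ι n            ≤⟨ +-monoˡ-≤ (r * ι n) k₀-bound ⟩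
    r₀ * ι n₀ + c + r * ι n   ≤⟨ +-monoˡ-≤ (r * ι n) (+-monoˡ-≤ c r₀n₀≤rn₀) ⟩
    r * ι n₀ + c + r * ι n    ≡⟨ solve 3 (λ x y c → x :+ c :+ y := y :+ c :+ x) refl (r * ι n₀) (r * ι n) c ⟩
    r * ι n + c + r * ι n₀    ∎)
  where
  open ℚ.≤-Reasoning
  open ℚSolver.+-*-Solver
  r : ℚ
  r = ratio (suc e)
  lhs rhs : ℕ
  lhs = suc e ℕ.* k ℕ.+ e ℕ.* n₀
  rhs = suc e ℕ.* k₀ ℕ.+ e ℕ.* n
  r₀n₀≤rn₀ : r₀ * ι n₀ ≤ℚ r * ι n₀
  r₀n₀≤rn₀ = *-monoʳ-≤-nonNeg (ι n₀) {{ι-nonNeg n₀}} r₀≤r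

indicator : Bool → ℕ
indicator b = if b then 1 else 0

count-suc : ∀ {m} (f : Fin (suc m) → Bool) → count f ≡ indicator (f zero) ℕ.+ count (f ∘ suc)
count-suc f = cong (indicator (f zero) ℕ.+_)
  (cong sum (trans (map-tabulate suc (indicator ∘ f))
                   (sym (map-tabulate (λ i → i) (indicator ∘ f ∘ suc)))))

count-cong : ∀ {m} {f g : Fin m → Bool} → (∀ i → f i ≡ g i) → count f ≡ count g
count-cong f≗g = cong sum (map-cong (cong indicator ∘ f≗g) (allFin _))

count-++ : ∀ m {k} (f : Fin (m ℕ.+ k) → Bool) →
  count f ≡ count (f ∘ (_↑ˡ k)) ℕ.+ count (f ∘ (m ↑ʳ_))
count-++ zero    f = refl
count-++ (suc m) {k} f = begin
  count f                                   ≡⟨ count-suc f ⟩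
  i₀ ℕ.+ count (f ∘ suc)                    ≡⟨ cong (i₀ ℕ.+_) (count-++ m (f ∘ suc)) ⟩
  i₀ ℕ.+ (count (f ∘ suc ∘ (_↑ˡ k)) ℕ.+ R)  ≡⟨ ℕ.+-assoc i₀ _ R ⟨
  i₀ ℕ.+ count (f ∘ suc ∘ (_↑ˡ k)) ℕ.+ R    ≡⟨ cong (ℕ._+ R) (count-suc (f ∘ (_↑ˡ k))) ⟨
  count (f ∘ (_↑ˡ k)) ℕ.+ R                 ∎
  where
  open ≡-Reasoning
  i₀ R : ℕ
  i₀ = indicator (f zero)
  R = count (f ∘ (suc m ↑ʳ_))

count-true : ∀ m → count {m} (λ _ → true) ≡ m
count-true zero    = refl
count-true (suc m) = trans (count-suc {m} (λ _ → true)) (cong suc (count-true m))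

count-pos : ∀ {m} (f : Fin m → Bool) x → f x ≡ true → 1 ≤ count f
count-pos f zero    fx≡true rewrite count-suc f | fx≡true = s≤s z≤n
count-pos f (suc x) fx≡true rewrite count-suc f =
  ℕ.≤-trans (count-pos (f ∘ suc) x fx≡true) (ℕ.m≤n+m _ (indicator (f zero)))

degree≤maxDegree : ∀ {m} (G : Graph m) x → degree G x ≤ maxDegree G
degree≤maxDegree G x =
  foldr-preservesᵒ {P = degree G x ≤_} (λ a b → [ ℕ.m≤n⇒m≤n⊔o b , ℕ.m≤n⇒m≤o⊔n a ]) 0 _
    (inj₂ (Any.map ℕ.≤-reflexive (∈-map⁺ (degree G) (∈-allFin x))))

maxDegree≤ : ∀ {m} (G : Graph m) {M} → (∀ x → degree G x ≤ M) → maxDegree G ≤ M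
maxDegree≤ G {M} degree≤M = foldr-preservesᵇ {P = _≤ M} ℕ.⊔-lub z≤n (map⁺ (tabulate⁺ degree≤M))

closedN-refl : ∀ {m} (G : Graph m) x → closedN G x x ≡ true
closedN-refl G x = cong (_∨ G x x) (dec-true (x ≟ x) refl)

-- The attached star is K_{1,1+k}: besides the leaf identified with v it has k leaves.
module Star {n : ℕ} (G : Graph n) (v : Fin n) (k : ℕ) where

  G⁺ : Graph (n ℕ.+ suc k)
  G⁺ = attachStar G v (suc k)

  old : Fin n → Fin (n ℕ.+ suc k)
  old a = a ↑ˡ suc k

  centre : Fin (n ℕ.+ suc k)
  centre = n ↑ʳ zero

  leaf : Fin k → Fin (n ℕ.+ suc k)
  leaf j = n ↑ʳ suc j

  data View : Fin (n ℕ.+ suc k) → Set where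
    old-view    : ∀ a → View (old a)
    centre-view : View centre
    leaf-view   : ∀ j → View (leaf j)

  view : ∀ x → View x
  view x with splitAt n x in eq
  ... | inj₁ a       = subst View (splitAt⁻¹-↑ˡ eq) (old-view a)
  ... | inj₂ zero    = subst View (splitAt⁻¹-↑ʳ eq) centre-view
  ... | inj₂ (suc j) = subst View (splitAt⁻¹-↑ʳ eq) (leaf-view j)

  old-old : ∀ a b → G⁺ (old a) (old b) ≡ G a b
  old-old a b rewrite splitAt-↑ˡ n a (suc k) | splitAt-↑ˡ n b (suc k) = refl

  old-leaf : ∀ a j → G⁺ (old a) (leaf j) ≡ false
  old-leaf a j rewrite splitAt-↑ˡ n a (suc k) | splitAt-↑ʳ n (suc k) (suc j) = refl

  leaf-leaf : ∀ i j → G⁺ (leaf i) (leaf j) ≡ false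
  leaf-leaf i j rewrite splitAt-↑ʳ n (suc k) (suc i) | splitAt-↑ʳ n (suc k) (suc j) = refl

  centre-old : ∀ a → G⁺ centre (old a) ≡ does (a ≟ v)
  centre-old a rewrite splitAt-↑ˡ n a (suc k) | splitAt-↑ʳ n (suc k) zero = refl

  centre-centre : G⁺ centre centre ≡ false
  centre-centre rewrite splitAt-↑ʳ n (suc k) zero = refl

  centre-leaf : ∀ j → G⁺ centre (leaf j) ≡ true
  centre-leaf j rewrite splitAt-↑ʳ n (suc k) zero | splitAt-↑ʳ n (suc k) (suc j) = refl

  old≢new : ∀ a j → old a ≢ n ↑ʳ j
  old≢new a j eq
    with trans (sym (splitAt-↑ˡ n a (suc k))) (trans (cong (splitAt n) eq) (splitAt-↑ʳ n (suc k) j))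
  ... | ()

  closedN-old-old : ∀ a b → closedN G⁺ (old a) (old b) ≡ closedN G a b
  closedN-old-old a b = cong₂ _∨_ (≟-old a b) (old-old a b)
    where
    ≟-old : ∀ a b → does (old a ≟ old b) ≡ does (a ≟ b)
    ≟-old a b with a ≟ b
    ... | yes refl = dec-true (old a ≟ old a) refl
    ... | no a≢b   = dec-false (old a ≟ old b) (a≢b ∘ ↑ˡ-injective (suc k) a b)

  closedN-old-leaf : ∀ a j → closedN G⁺ (old a) (leaf j) ≡ false
  closedN-old-leaf a j = cong₂ _∨_ (dec-false (old a ≟ leaf j) (old≢new a (suc j))) (old-leaf a j)

  closedN-centre-leaf : ∀ j → closedN G⁺ centre (leaf j) ≡ true
  closedN-centre-leaf j = trans (cong (does (centre ≟ leaf j) ∨_) (centre-leaf j)) (∨-zeroʳ _)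

  closedN-leaf-leaf : ∀ i j → i ≢ j → closedN G⁺ (leaf i) (leaf j) ≡ false
  closedN-leaf-leaf i j i≢j =
    cong₂ _∨_ (dec-false (leaf i ≟ leaf j) (i≢j ∘ suc-injective ∘ ↑ʳ-injective n _ _)) (leaf-leaf i j)

  count-new : ∀ f → f centre ≡ false → (∀ j → f (leaf j) ≡ true) → count (f ∘ (n ↑ʳ_)) ≡ k
  count-new f f-centre f-leaf = begin
    count (f ∘ (n ↑ʳ_))                      ≡⟨ count-suc (f ∘ (n ↑ʳ_)) ⟩
    indicator (f centre) ℕ.+ count (f ∘ leaf) ≡⟨ cong₂ ℕ._+_ (cong indicator f-centre) (count-cong f-leaf) ⟩
    count {k} (λ _ → true)                   ≡⟨ count-true k ⟩
    k                                        ∎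
    where open ≡-Reasoning

  degree-old-mono : ∀ a → degree G a ≤ degree G⁺ (old a)
  degree-old-mono a = begin
    degree G a                                  ≡⟨ count-cong (sym ∘ old-old a) ⟩
    count (G⁺ (old a) ∘ old)                    ≤⟨ ℕ.m≤m+n _ _ ⟩
    count (G⁺ (old a) ∘ old) ℕ.+ count (G⁺ (old a) ∘ (n ↑ʳ_)) ≡⟨ count-++ n (G⁺ (old a)) ⟨
    degree G⁺ (old a)                           ∎
    where open ℕ.≤-Reasoning

  star≤degree-centre : suc k ≤ degree G⁺ centre
  star≤degree-centre = begin
    1 ℕ.+ k
      ≤⟨ ℕ.+-mono-≤ (count-pos _ v v-adjacent) (ℕ.≤-reflexive (sym new-neighbours)) ⟩
    count (G⁺ centre ∘ old) ℕ.+ count (G⁺ centre ∘ (n ↑ʳ_))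
      ≡⟨ count-++ n (G⁺ centre) ⟨
    degree G⁺ centre
      ∎
    where
    open ℕ.≤-Reasoning
    v-adjacent : G⁺ centre (old v) ≡ true
    v-adjacent = trans (centre-old v) (dec-true (v ≟ v) refl)
    new-neighbours : count (G⁺ centre ∘ (n ↑ʳ_)) ≡ k
    new-neighbours = count-new (G⁺ centre) centre-centre centre-leaf

  maxDegree-mono : maxDegree G ≤ maxDegree G⁺
  maxDegree-mono = maxDegree≤ G (λ a → ℕ.≤-trans (degree-old-mono a) (degree≤maxDegree G⁺ (old a)))

  star≤maxDegree : suc k ≤ maxDegree G⁺
  star≤maxDegree = ℕ.≤-trans star≤degree-centre (degree≤maxDegree G⁺ centre)

  isLeaf : Fin (suc k) → Bool
  isLeaf zero    = false
  isLeaf (suc _) = true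

  extend : (Fin n → Bool) → Fin (n ℕ.+ suc k) → Bool
  extend C x = [ C , isLeaf ] (splitAt n x)

  extend-old : ∀ C a → extend C (old a) ≡ C a
  extend-old C a rewrite splitAt-↑ˡ n a (suc k) = refl

  extend-centre : ∀ C → extend C centre ≡ false
  extend-centre C rewrite splitAt-↑ʳ n (suc k) zero = refl

  extend-leaf : ∀ C j → extend C (leaf j) ≡ true
  extend-leaf C j rewrite splitAt-↑ʳ n (suc k) (suc j) = refl

  count-extend : ∀ C → count (extend C) ≡ count C ℕ.+ k
  count-extend C = trans (count-++ n (extend C))
    (cong₂ ℕ._+_ (count-cong (extend-old C)) (count-new (extend C) (extend-centre C) (extend-leaf C)))

Separates : ∀ {m} → Graph m → (Fin m → Bool) → Fin m → Fin m → Set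
Separates {m} G C x y = Σ (Fin m) λ w → (C w ≡ true) × (closedN G x w ≢ closedN G y w)

-- The new leaves are codewords with N[leaf j] = {leaf j, centre}, so they separate every new vertex
-- from all others; telling the centre from a leaf needs a second leaf.
extend-isIdCode : ∀ {n} (G : Graph n) v t {C} → IsIdCode G C →
  let open Star G v (suc (suc t)) in IsIdCode G⁺ (extend C)
extend-isIdCode G v t {C} (dominating , separating) = dominating⁺ , separating⁺
  where
  open Star G v (suc (suc t))

  true≢false : ∀ {p q} → p ≡ true → q ≡ false → p ≢ q
  true≢false refl refl ()

  by-leaf : ∀ {x y} j → closedN G⁺ x (leaf j) ≡ true → closedN G⁺ y (leaf j) ≡ false →
    Separates G⁺ (extend C) x y
  by-leaf j x∼j y≁j = leaf j , extend-leaf C j , true≢false x∼j y≁j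

  another : ∀ (j : Fin (suc (suc t))) → Σ _ (j ≢_)
  another j = punchIn j zero , punchInᵢ≢i j zero ∘ sym

  dominating⁺ : ∀ x → Σ _ λ w → (extend C w ≡ true) × (closedN G⁺ x w ≡ true)
  dominating⁺ x with view x
  ... | old-view a  = let w , w∈C , a∼w = dominating a in
                      old w , trans (extend-old C w) w∈C , trans (closedN-old-old a w) a∼w
  ... | centre-view = leaf zero , extend-leaf C zero , closedN-centre-leaf zero
  ... | leaf-view j = leaf j , extend-leaf C j , closedN-refl G⁺ (leaf j)

  old-old-separated : ∀ a b → a ≢ b → Separates G⁺ (extend C) (old a) (old b)
  old-old-separated a b a≢b =
    let w , w∈C , Na≢Nb = separating a b a≢b in
    old w , trans (extend-old C w) w∈C ,
    λ eq → Na≢Nb (trans (sym (closedN-old-old a w)) (trans eq (closedN-old-old b w)))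

  centre-old-separated : ∀ a → Separates G⁺ (extend C) centre (old a)
  centre-old-separated a = by-leaf zero (closedN-centre-leaf zero) (closedN-old-leaf a zero)

  centre-leaf-separated : ∀ j → Separates G⁺ (extend C) centre (leaf j)
  centre-leaf-separated j =
    let i , j≢i = another j in by-leaf i (closedN-centre-leaf i) (closedN-leaf-leaf j i j≢i)

  leaf-old-separated : ∀ j a → Separates G⁺ (extend C) (leaf j) (old a)
  leaf-old-separated j a = by-leaf j (closedN-refl G⁺ (leaf j)) (closedN-old-leaf a j)

  leaf-leaf-separated : ∀ i j → i ≢ j → Separates G⁺ (extend C) (leaf i) (leaf j)
  leaf-leaf-separated i j i≢j = by-leaf i (closedN-refl G⁺ (leaf i)) (closedN-leaf-leaf j i (i≢j ∘ sym))

  swap : ∀ {x y} → Separates G⁺ (extend C) x y → Separates G⁺ (extend C) y x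
  swap (w , w∈C , Nx≢Ny) = w , w∈C , Nx≢Ny ∘ sym

  separating⁺ : ∀ x y → x ≢ y → Separates G⁺ (extend C) x y
  separating⁺ x y x≢y with view x | view y
  ... | old-view a  | old-view b  = old-old-separated a b (x≢y ∘ cong old)
  ... | old-view a  | centre-view = swap (centre-old-separated a)
  ... | old-view a  | leaf-view j = swap (leaf-old-separated j a)
  ... | centre-view | old-view a  = centre-old-separated a
  ... | centre-view | centre-view = ⊥-elim (x≢y refl)
  ... | centre-view | leaf-view j = centre-leaf-separated j
  ... | leaf-view j | old-view a  = leaf-old-separated j a
  ... | leaf-view j | centre-view = swap (centre-leaf-separated j)
  ... | leaf-view i | leaf-view j = leaf-leaf-separated i j (x≢y ∘ cong leaf)

-- D·|C| − (D−1)·|V| (with D = suc e) does not increase when a star adds k + 1 ≤ D vertices and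
-- k codewords; stated with both sides moved so that no subtraction occurs.
star-keeps-potential : ∀ e k {A B K K′ m} → k ≤ e → K′ ≡ K ℕ.+ k →
  A ℕ.+ e ℕ.* (m ℕ.+ suc k) ≤ suc e ℕ.* K′ ℕ.+ B → A ℕ.+ e ℕ.* m ≤ suc e ℕ.* K ℕ.+ B
star-keeps-potential e k {A} {B} {K} {m = m} k≤e refl potential = ℕ.+-cancelʳ-≤ (e ℕ.* suc k) _ _ (begin
  A ℕ.+ e ℕ.* m ℕ.+ e ℕ.* suc k       ≡⟨ regroupˡ A e m (suc k) ⟩
  A ℕ.+ e ℕ.* (m ℕ.+ suc k)           ≤⟨ potential ⟩
  suc e ℕ.* (K ℕ.+ k) ℕ.+ B           ≡⟨ regroupʳ (suc e) K k B ⟩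
  suc e ℕ.* K ℕ.+ B ℕ.+ suc e ℕ.* k   ≤⟨ ℕ.+-monoʳ-≤ (suc e ℕ.* K ℕ.+ B) leaves≤slope ⟩
  suc e ℕ.* K ℕ.+ B ℕ.+ e ℕ.* suc k   ∎)
  where
  open ℕ.≤-Reasoning
  regroupˡ : ∀ A e m s → A ℕ.+ e ℕ.* m ℕ.+ e ℕ.* s ≡ A ℕ.+ e ℕ.* (m ℕ.+ s)
  regroupˡ = ℕSolver.solve-∀
  regroupʳ : ∀ d K k B → d ℕ.* (K ℕ.+ k) ℕ.+ B ≡ d ℕ.* K ℕ.+ B ℕ.+ d ℕ.* k
  regroupʳ = ℕSolver.solve-∀
  leaves≤slope : suc e ℕ.* k ≤ e ℕ.* suc k
  leaves≤slope = begin
    k ℕ.+ e ℕ.* k  ≤⟨ ℕ.+-monoˡ-≤ (e ℕ.* k) k≤e ⟩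
    e ℕ.+ e ℕ.* k  ≡⟨ ℕ.*-suc e k ⟨
    e ℕ.* suc k    ∎

idCode-build-potential : ∀ e {m} (G : Graph m) {C} → IsIdCode G C → (ch : Chain m) → AllDegGe3 ch →
  chainMaxDeg ch ≤ suc e →
  Σ (Fin (finalOrder ch) → Bool) λ C′ → IsIdCode (build G ch) C′ ×
    (suc e ℕ.* count C′ ℕ.+ e ℕ.* m ≤ suc e ℕ.* count C ℕ.+ e ℕ.* finalOrder ch)
idCode-build-potential e G code done _ _ = _ , code , ℕ.≤-refl
idCode-build-potential e G {C} code (step v (suc (suc (suc t))) ch) (s≤s (s≤s (s≤s _)) , ≥3) Δ≤D =
  let C′ , code′ , potential =
        idCode-build-potential e G⁺ (extend-isIdCode G v t code) ch ≥3 (ℕ.m⊔n≤o⇒n≤o _ _ Δ≤D)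
  in C′ , code′ , star-keeps-potential e (suc (suc t)) (ℕ.≤-pred (ℕ.m⊔n≤o⇒m≤o _ (chainMaxDeg ch) Δ≤D))
                    (count-extend C) potential
  where open Star G v (suc (suc t))

maxDegree-build : ∀ {m} (G : Graph m) ch → AllDegGe3 ch → maxDegree G ≤ maxDegree (build G ch)
maxDegree-build G done _ = ℕ.≤-refl
maxDegree-build G (step v (suc (suc (suc t))) ch) (s≤s (s≤s (s≤s _)) , ≥3) =
  ℕ.≤-trans maxDegree-mono (maxDegree-build G⁺ ch ≥3)
  where open Star G v (suc (suc t))

chainMaxDeg-build : ∀ {m} (G : Graph m) ch → AllDegGe3 ch → chainMaxDeg ch ≤ maxDegree (build G ch)
chainMaxDeg-build G done _ = z≤n
chainMaxDeg-build G (step v (suc (suc (suc t))) ch) (s≤s (s≤s (s≤s _)) , ≥3) =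
  ℕ.⊔-lub (ℕ.≤-trans star≤maxDegree (maxDegree-build G⁺ ch ≥3)) (chainMaxDeg-build G⁺ ch ≥3)
  where open Star G v (suc (suc t))

module _ {A : Set} (P : A → Set) (size : A → ℕ) where

  Minimum : Set
  Minimum = Σ A λ a → P a × ∀ b → P b → size a ≤ size b

  ¬¬-minimum : ∀ {a} → P a → ¬ ¬ Minimum
  ¬¬-minimum {a} = search (size a) a ℕ.≤-refl
    where
    search : ∀ bound a → size a ≤ bound → P a → ¬ ¬ Minimum
    search zero a a≤0 pa ¬min = ¬min (a , pa , λ _ _ → ℕ.≤-trans a≤0 z≤n)
    search (suc bound) a a≤bound pa ¬min = ¬min (a , pa , λ b pb →
      decidable-stable (size a ℕ.≤? size b)
        (λ a≰b → search bound b (ℕ.≤-pred (ℕ.≤-trans (ℕ.≰⇒> a≰b) a≤bound)) pb ¬min))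

true-isIdCode : ∀ {m} (G : Graph m) → Identifiable G → IsIdCode G (λ _ → true)
true-isIdCode G identifiable =
  (λ x → x , refl , closedN-refl G x) ,
  (λ x y x≢y → let w , Nx≢Ny = identifiable x y x≢y in w , refl , Nx≢Ny)

¬¬-γID : ∀ {m} (G : Graph m) → Identifiable G → ¬ ¬ Σ ℕ (IsGammaID G)
¬¬-γID G identifiable = ¬¬-map (λ (C , code , minimal) → count C , (C , code , refl) , minimal)
  (¬¬-minimum (IsIdCode G) count (true-isIdCode G identifiable))

γID-build-potential : ∀ e {m} (G : Graph m) ch → AllDegGe3 ch → chainMaxDeg ch ≤ suc e →
  ∀ {k₀ k} → IsGammaID G k₀ → IsGammaID (build G ch) k →
  suc e ℕ.* k ℕ.+ e ℕ.* m ≤ suc e ℕ.* k₀ ℕ.+ e ℕ.* finalOrder ch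
γID-build-potential e G ch ≥3 Δ≤D ((C₀ , code₀ , refl) , _) (_ , minimal) =
  let C , code , potential = idCode-build-potential e G code₀ ch ≥3 Δ≤D
  in ℕ.≤-trans (ℕ.+-monoˡ-≤ _ (ℕ.*-monoʳ-≤ (suc e) (minimal C code))) potential

lemma4p3 : (c : ℚ) {n₀ : ℕ} (G₀ : Graph n₀) → IsSimple G₀ → Identifiable G₀ →
    1 ≤ maxDegree G₀ →
    (∀ k₀ → IsGammaID G₀ k₀ →
      (+ k₀ / 1) ≤ℚ ratio (maxDegree G₀) * (+ n₀ / 1) + c) →
    (ch : Chain n₀) → 1 ≤ chainLength ch → AllDegGe3 ch →
    let G = build G₀ ch
        n = finalOrder ch
        Δ = maxDegree G
        Δmax = maxDegree G₀ ⊔ chainMaxDeg ch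
    in ∀ k → IsGammaID G k →
      ((+ k / 1) ≤ℚ ratio Δmax * (+ n / 1) + c)
      × (ratio Δmax * (+ n / 1) + c ≤ℚ ratio Δ * (+ n / 1) + c)
lemma4p3 c {n₀} G₀ _ identifiable 1≤Δ₀ bound₀ ch _ ≥3 k γ =
  bound-at 1≤Δmax Δ₀≤Δmax chain≤Δmax ,
  +-monoˡ-≤ c (*-monoʳ-≤-nonNeg (ι n) {{ι-nonNeg n}} (ratio-mono-≤ 1≤Δmax Δmax≤Δ))
  where
  Δ₀ Δmax n : ℕ
  Δ₀ = maxDegree G₀
  Δmax = Δ₀ ⊔ chainMaxDeg ch
  n = finalOrder ch

  Δ₀≤Δmax : Δ₀ ≤ Δmax
  Δ₀≤Δmax = ℕ.m≤m⊔n Δ₀ (chainMaxDeg ch)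

  chain≤Δmax : chainMaxDeg ch ≤ Δmax
  chain≤Δmax = ℕ.m≤n⊔m Δ₀ (chainMaxDeg ch)

  1≤Δmax : 1 ≤ Δmax
  1≤Δmax = ℕ.≤-trans 1≤Δ₀ Δ₀≤Δmax

  Δmax≤Δ : Δmax ≤ maxDegree (build G₀ ch)
  Δmax≤Δ = ℕ.⊔-lub (maxDegree-build G₀ ch ≥3) (chainMaxDeg-build G₀ ch ≥3)

  -- A minimum identifying code of G₀ exists only up to double negation, which the decidable goal absorbs.
  bound-at : ∀ {D} → 1 ≤ D → Δ₀ ≤ D → chainMaxDeg ch ≤ D → ι k ≤ℚ ratio D * ι n + c
  bound-at {suc e} _ Δ₀≤D chain≤D = decidable-stable (ι k ≤ℚ? ratio (suc e) * ι n + c) λ ¬bound →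
    ¬¬-γID G₀ identifiable λ (k₀ , γ₀) →
      ¬bound (slope-bound c e (γID-build-potential e G₀ ch ≥3 chain≤D γ₀ γ)
                              (ratio-mono-≤ 1≤Δ₀ Δ₀≤D) (bound₀ k₀ γ₀))
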